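{- Let $A$ be a simple type equipped with a type structure $\mathrm{ty}$ (as described in the context), let $f,g:A$ be extensionally equal, let $\tau:\mathcal{C}\,A$ and $t\in\mathbf{T}$. If $f\sim^{\tau}t$ then $g\sim^{\tau}t$.
   Context: The weak call-by-value $\lambda$-calculus L has terms $\mathbf{T}$ given by $s,t ::= n \mid s\,t \mid \lambda s$ ($n$ a natural number, de Bruijn indices). Substitution $s[k:=u]$: $k[k:=u]=u$, $n[k:=u]=n$ for $n\neq k$, $(st)[k:=u]=(s[k:=u])(t[k:=u])$, $(\lambda s)[k:=u]=\lambda(s[k+1:=u])$. Reduction $\succ$ is the least relation with $(\lambda s)(\lambda t)\succ s[0:=\lambda t]$, $s\succ s' \Rightarrow st\succ s't$, $t\succ t'\Rightarrow st\succ st'$; $s\succ^{\le n}t$ means $s$ reduces to $t$ in at most $n$ steps. A procedure is a closed abstraction. An encoding function for a type $A$ is an injective $\varepsilon_A:A\to\mathbf{T}$ all of whose values are procedures. A type structure $\mathrm{ty}$ on $A$ is generated by: (base) $A$ is a type with a given encoding function $\varepsilon_A$; (arrow) $A=B\to B'$ with type structures on $B$ and $B'$. Complexity measures: $\mathcal{C}\,A=\mathbf{1}$ (unit type) for base $A$, and $\mathcal{C}(B\to B')=B\to\mathcal{C}\,B\to\mathbb{N}\times\mathcal{C}\,B'$. The relation $a\sim^{\tau}t$ (for $a:A$, $\tau:\mathcal{C}A$, $t\in\mathbf{T}$) is defined by recursion on the type structure: for base $A$, $a\sim^{\tau}t$ iff $t=\varepsilon_A(a)$; for $f:B\to B'$,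 $f\sim^{\tau}t_f$ iff $t_f$ is a procedure and for all $b:B$, $t_b\in\mathbf{T}$, $\tau_b:\mathcal{C}B$ with $b\sim^{\tau_b}t_b$ there is $v\in\mathbf{T}$ with $t_f\,t_b\succ^{\le n}v$ and $f\,b\sim^{\tau'}v$, where $(n,\tau')=\tau\,b\,\tau_b$. Extensional equality, defined by recursion on the type structure: elements of a base type are extensionally equal iff equal; $f,g:B\to B'$ are extensionally equal iff $f\,b$ and $g\,b$ are extensionally equal for all $b:B$. -}

module Defs where

open import Data.Nat using (ℕ; zero; suc; _<_; _≟_)
open import Data.Product using (_×_; _,_; Σ; ∃; ∃-syntax)
open import Data.Unit using (⊤)
open import Relation.Binary.PropositionalEquality using (_≡_)
open import Relation.Nullary using (yes; no)
open import Function.Definitions using (Injective)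

data Term : Set where
  var : ℕ → Term
  app : Term → Term → Term
  lam : Term → Term

subst : Term → ℕ → Term → Term
subst (var n) k u with n ≟ k
... | yes _ = u
... | no _  = var n
subst (app s t) k u = app (subst s k u) (subst t k u)
subst (lam s) k u = lam (subst s (suc k) u)

data _≻_ : Term → Term → Set where
  β    : ∀ {s t} → app (lam s) (lam t) ≻ subst s 0 (lam t)
  appL : ∀ {s s' t} → s ≻ s' → app s t ≻ app s' t
  appR : ∀ {s t t'} → t ≻ t' → app s t ≻ app s t'

data _≻^≤_⟶_ : Term → ℕ → Term → Set where
  stop : ∀ {s n} → s ≻^≤ n ⟶ s
  step : ∀ {s t u n} → s ≻ t → t ≻^≤ n ⟶ u → s ≻^≤ suc n ⟶ u

data BoundBy : ℕ → Term → Set where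
  var : ∀ {k n} → n < k → BoundBy k (var n)
  app : ∀ {k s t} → BoundBy k s → BoundBy k t → BoundBy k (app s t)
  lam : ∀ {k s} → BoundBy (suc k) s → BoundBy k (lam s)

Closed : Term → Set
Closed = BoundBy 0

Procedure : Term → Set
Procedure t = Closed t × ∃[ s ] (t ≡ lam s)

data TyStr : Set → Set₁ where
  base  : {A : Set} (ε : A → Term) → Injective _≡_ _≡_ ε
          → ((a : A) → Procedure (ε a)) → TyStr A
  arrow : {B B' : Set} → TyStr B → TyStr B' → TyStr (B → B')

Cx : {A : Set} → TyStr A → Set
Cx (base _ _ _) = ⊤
Cx (arrow {B} tB tB') = B → Cx tB → ℕ × Cx tB'

Rel : {A : Set} (ty : TyStr A) → A → Cx ty → Term → Set
Rel (base ε _ _) a τ t = t ≡ ε a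
Rel (arrow {B} tB tB') f τ tf =
  Procedure tf ×
  ((b : B) (tb : Term) (τb : Cx tB) → Rel tB b τb tb →
     Σ Term λ v → Σ (app tf tb ≻^≤ Data.Product.proj₁ (τ b τb) ⟶ v) λ _ →
       Rel tB' (f b) (Data.Product.proj₂ (τ b τb)) v)

ExtEq : {A : Set} → TyStr A → A → A → Set
ExtEq (base _ _ _) a a' = a ≡ a'
ExtEq (arrow {B} tB tB') f g = (b : B) → ExtEq tB' (f b) (g b)

module Submission where

-- The relation ∼^τ only ever inspects an element of a function type through
-- its values: at a base type it compares the encoding of the element, and at
-- an arrow type  B → B'  it asks, for each argument  b, about the value  f b
-- at the smaller type  B'.  Extensional equality says exactly that two
-- elements have the same base-type values in this sense.  The proof is
-- therefore an induction on the type structure: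
--   * at a base type extensional equality is equality, so there is nothing
--     to do;
--   * at an arrow type the procedure part of the relation does not mention
--     the function, and the simulation clause for  f  is turned into the one
--     for  g  by keeping the witness term and reduction and applying the
--     induction hypothesis at  B'  to the extensionally equal values  f b, g b.

open import Defs
open import Data.Product using (Σ; _,_; proj₁; proj₂)
open import Relation.Binary.PropositionalEquality using (refl)

mainTheorem4 : {A : Set} (ty : TyStr A) (f g : A) → ExtEq ty f g →
    (τ : Cx ty) (t : Term) → Rel ty f τ t → Rel ty g τ t
mainTheorem4 (base _ _ _) f .f refl τ t f∼t = f∼t
mainTheorem4 (arrow tB tB') f g f≈g τ t (t-procedure , simulate-f) =
  t-procedure , simulate-g
  where
    simulate-g : ∀ b tb τb → Rel tB b τb tb →
      Σ Term λ v → Σ (app t tb ≻^≤ proj₁ (τ b τb) ⟶ v) λ _ →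
        Rel tB' (g b) (proj₂ (τ b τb)) v
    simulate-g b tb τb b∼tb with simulate-f b tb τb b∼tb
    ... | v , reduction , fb∼v =
      v , reduction , mainTheorem4 tB' (f b) (g b) (f≈g b) (proj₂ (τ b τb)) v fb∼v
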